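{- Let \(\mathbb{E}\) be the set of positive even integers, \(M,N\subseteq\mathbb{E}\), and let \(u\colon\mathbf{D}_M\to\mathbf{D}_N\) be an embedding. Then \(u(\{d\})=\{d\}\).
   Context: The complex algebra \(\mathsf{Cm}(\langle W;R\rangle)\) is the power set Boolean algebra of \(W\) with \(\Diamond X=\{w\in W\mid w\,R\,x\text{ for some }x\in X\}\). For \(N\subseteq\mathbb{E}\), the frame \(\mathbb{F}_N=\langle W;R_N\rangle\): \(W\) consists of pairwise distinct elements \(a,b_1,b_2,b_3,c_1,c_2,d\), \(u_i\) (\(i\geqslant 1\)) and \(\ell_i\) (\(i\geqslant 0\)); \(R_N\) is the reflexive symmetric relation on \(W\) whose non-loop edges \(\{x,y\}\) are exactly: \(\{a,b_i\}\) for \(i\in\{1,2,3\}\); \(\{b_i,c_i\}\) for \(i\in\{1,2\}\); \(\{c_1,d\}\); \(\{\ell_0,\ell_1\}\); \(\{a,\ell_i\}\) for all \(i\geqslant 0\); \(\{\ell_i,u_i\}\) for all \(i\geqslant 1\); \(\{\ell_i,u_{i-1}\}\) for \(i\in\mathbb{E}\); \(\{\ell_i,u_{i+1}\}\) for \(i\in N\); \(\{\ell_{i+1},u_i\}\) for \(i\in\mathbb{E}\setminus N\). \(\mathbf{D}_N\) is the subalgebra of \(\mathsf{Cm}(\mathbb{F}_N)\) generated by \(\{d\}\) (a Boolean algebra with operator \(\Diamond\)); an embedding is an injective homomorphism of these algebras. -}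

module Defs where

open import Data.Nat using (ℕ; zero; suc; _*_; _∸_)
open import Data.Product using (Σ; ∃; _×_; _,_; proj₁; proj₂)
open import Data.Sum using (_⊎_)
open import Data.Empty using (⊥)
open import Relation.Nullary using (¬_)
open import Relation.Binary.PropositionalEquality using (_≡_)
open import Level using (Level) renaming (suc to lsuc; zero to lzero)

IsE : ℕ → Set
IsE i = ∃ λ k → i ≡ 2 * suc k

SubE : Set₁
SubE = Σ (ℕ → Set) λ N → ∀ i → N i → IsE i

-- Points of the frame.  'u k' denotes u_{k+1} (so u_i, i ≥ 1, is 'u (i ∸ 1)');
-- 'ℓ i' denotes ℓ_i (i ≥ 0).
data W : Set where
  a b₁ b₂ b₃ c₁ c₂ d : W
  u ℓ : ℕ → W

-- non-loop edges, listed in one orientation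
data Edge (N : ℕ → Set) : W → W → Set where
  ab₁ : Edge N a b₁
  ab₂ : Edge N a b₂
  ab₃ : Edge N a b₃
  b₁c₁ : Edge N b₁ c₁
  b₂c₂ : Edge N b₂ c₂
  c₁d : Edge N c₁ d
  ℓ₀ℓ₁ : Edge N (ℓ 0) (ℓ 1)
  aℓ : ∀ i → Edge N a (ℓ i)
  -- {ℓ_i, u_i}, i ≥ 1  (i = suc k)
  ℓu-same : ∀ k → Edge N (ℓ (suc k)) (u k)
  -- {ℓ_i, u_{i-1}}, i ∈ 𝔼
  ℓu-prev : ∀ i → IsE i → Edge N (ℓ i) (u (i ∸ 2))
  -- {ℓ_i, u_{i+1}}, i ∈ N
  ℓu-next : ∀ i → N i → Edge N (ℓ i) (u i)
  -- {ℓ_{i+1}, u_i}, i ∈ 𝔼 ∖ N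
  ℓu-back : ∀ i → IsE i → ¬ N i → Edge N (ℓ (suc i)) (u (i ∸ 1))

R : SubE → W → W → Set
R N x y = x ≡ y ⊎ Edge (proj₁ N) x y ⊎ Edge (proj₁ N) y x

Sub : Set₁
Sub = W → Set

_≐_ : Sub → Sub → Set
X ≐ Y = ∀ w → (X w → Y w) × (Y w → X w)

∅ : Sub
∅ _ = ⊥

∁ : Sub → Sub
∁ X w = ¬ X w

_∪_ : Sub → Sub → Sub
(X ∪ Y) w = X w ⊎ Y w

◇ : SubE → Sub → Sub
◇ N X w = ∃ λ x → R N w x × X x

｛d｝ : Sub
｛d｝ w = w ≡ d

-- D_N : the subalgebra of Cm(F_N) generated by {d}
-- (closed under the Boolean operations and ◇; membership is
--  invariant under extensional equality of subsets)
data Gen (N : SubE) : Sub → Set₁ where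
  g-d : Gen N ｛d｝
  g-∅ : Gen N ∅
  g-∁ : ∀ {X} → Gen N X → Gen N (∁ X)
  g-∪ : ∀ {X Y} → Gen N X → Gen N Y → Gen N (X ∪ Y)
  g-◇ : ∀ {X} → Gen N X → Gen N (◇ N X)
  g-≐ : ∀ {X Y} → X ≐ Y → Gen N X → Gen N Y

D : SubE → Set₁
D N = Σ Sub (Gen N)

dD : (N : SubE) → D N
dD N = ｛d｝ , g-d

-- an embedding D_M → D_N: a well-defined injective homomorphism of
-- Boolean algebras with operator (⊤, ∩ are derived from ∅, ∁, ∪)
record Embedding (M N : SubE) : Set₁ where
  field
    f : D M → D N
    f-resp : ∀ X Y → proj₁ X ≐ proj₁ Y → proj₁ (f X) ≐ proj₁ (f Y)
    f-∅ : proj₁ (f (∅ , g-∅)) ≐ ∅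
    f-∁ : ∀ X → proj₁ (f (∁ (proj₁ X) , g-∁ (proj₂ X))) ≐ ∁ (proj₁ (f X))
    f-∪ : ∀ X Y → proj₁ (f (proj₁ X ∪ proj₁ Y , g-∪ (proj₂ X) (proj₂ Y)))
                    ≐ (proj₁ (f X) ∪ proj₁ (f Y))
    f-◇ : ∀ X → proj₁ (f (◇ M (proj₁ X) , g-◇ (proj₂ X))) ≐ ◇ N (proj₁ (f X))
    f-inj : ∀ X Y → proj₁ (f X) ≐ proj₁ (f Y) → proj₁ X ≐ proj₁ Y

-- Write P for the image of {d}.  Every point other than d lies within distance 2 of a, so if P
-- contained a point other than d, then a would lie in ◇²P.  Two Boolean-modal facts about {d},
--   (i)  ◇⁴{d} is not everything (c₂ is at distance 5 from d), and
--   (ii) every point at distance 3 from {d} has a neighbour at distance 4 that is a dead end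
--        (the only such point is a, and b₃ is such a neighbour),
-- hold in D_M and transfer along the embedding to P in D_N.  But from a ∈ ◇²P, fact (i) forces
-- d ∉ ◇⁴P (otherwise ◇⁴P is everything), and then b₁ violates (ii).  Hence P ⊆ {d}, and P ≠ ∅
-- by injectivity.
module Submission where

open import Defs
open import Data.Product using (proj₁; proj₂; _,_; _×_; ∃)
open import Data.Sum using (_⊎_; inj₁; inj₂; [_,_])
open import Data.Empty using (⊥-elim)
open import Data.Nat using (ℕ; zero; suc; _≤_; _≤ᵇ_; z≤n; s≤s)
open import Data.Nat.Properties using (≤-trans; ≤ᵇ⇒≤; n≤1+n; 1+n≰n)
open import Data.Bool using (T)
open import Relation.Nullary using (¬_; Dec; yes; no)
open import Relation.Nullary.Decidable using (toSum)
open import Relation.Nullary.Negation using (negated-stable)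
open import Relation.Binary.PropositionalEquality using (_≡_; _≢_; refl; subst)

private
  variable
    A B : Set
    N : SubE
    Q X X′ Y Y′ Z : Sub
    w x y : W

≐-refl : X ≐ X
≐-refl w = (λ p → p) , (λ p → p)

≐-sym : X ≐ Y → Y ≐ X
≐-sym X≐Y w = proj₂ (X≐Y w) , proj₁ (X≐Y w)

≐-trans : X ≐ Y → Y ≐ Z → X ≐ Z
≐-trans X≐Y Y≐Z w =
  (λ p → proj₁ (Y≐Z w) (proj₁ (X≐Y w) p)) , (λ p → proj₂ (X≐Y w) (proj₂ (Y≐Z w) p))

∁-cong : X ≐ Y → ∁ X ≐ ∁ Y
∁-cong X≐Y w = (λ ¬p q → ¬p (proj₂ (X≐Y w) q)) , (λ ¬q p → ¬q (proj₁ (X≐Y w) p))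

∪-cong : X ≐ X′ → Y ≐ Y′ → (X ∪ Y) ≐ (X′ ∪ Y′)
∪-cong X≐X′ Y≐Y′ w =
  [ (λ p → inj₁ (proj₁ (X≐X′ w) p)) , (λ q → inj₂ (proj₁ (Y≐Y′ w) q)) ] ,
  [ (λ p → inj₁ (proj₂ (X≐X′ w) p)) , (λ q → inj₂ (proj₂ (Y≐Y′ w) q)) ]

◇-cong : X ≐ Y → ◇ N X ≐ ◇ N Y
◇-cong X≐Y w =
  (λ { (x , r , p) → x , r , proj₁ (X≐Y x) p }) , (λ { (x , r , q) → x , r , proj₂ (X≐Y x) q })

≐∅-intro : (∀ w → ¬ X w) → X ≐ ∅
≐∅-intro empty w = empty w , ⊥-elim

≐⊤-intro : (∀ w → X w) → X ≐ ∁ ∅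
≐⊤-intro full w = (λ _ ()) , (λ _ → full w)

_≟d : (w : W) → Dec (w ≡ d)
a ≟d = no λ ()
b₁ ≟d = no λ ()
b₂ ≟d = no λ ()
b₃ ≟d = no λ ()
c₁ ≟d = no λ ()
c₂ ≟d = no λ ()
d ≟d = yes refl
u _ ≟d = no λ ()
ℓ _ ≟d = no λ ()

≐｛d｝-intro : {X : Sub} → (∀ w → X w → w ≡ d) → ¬ (X ≐ ∅) → X d ⊎ ¬ X d → X ≐ ｛d｝
≐｛d｝-intro X⊆｛d｝ X≢∅ (inj₁ Xd) w = X⊆｛d｝ w , λ { refl → Xd }
≐｛d｝-intro {X} X⊆｛d｝ X≢∅ (inj₂ ¬Xd) =
  ⊥-elim (X≢∅ (≐∅-intro λ w Xw → ¬Xd (subst X (X⊆｛d｝ w Xw) Xw)))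

infixl 6 _∪ₜ_ _∖ₜ_
data Term : Set where
  var ∅ₜ : Term
  ∁ₜ_ ◇ₜ_ : Term → Term
  _∪ₜ_ : Term → Term → Term

⟦_⟧ : Term → SubE → Sub → Sub
⟦ var ⟧ N P = P
⟦ ∅ₜ ⟧ N P = ∅
⟦ ∁ₜ t ⟧ N P = ∁ (⟦ t ⟧ N P)
⟦ s ∪ₜ t ⟧ N P = ⟦ s ⟧ N P ∪ ⟦ t ⟧ N P
⟦ ◇ₜ t ⟧ N P = ◇ N (⟦ t ⟧ N P)

Gen-⟦⟧ : (t : Term) → Gen N (⟦ t ⟧ N ｛d｝)
Gen-⟦⟧ var = g-d
Gen-⟦⟧ ∅ₜ = g-∅
Gen-⟦⟧ (∁ₜ t) = g-∁ (Gen-⟦⟧ t)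
Gen-⟦⟧ (s ∪ₜ t) = g-∪ (Gen-⟦⟧ s) (Gen-⟦⟧ t)
Gen-⟦⟧ (◇ₜ t) = g-◇ (Gen-⟦⟧ t)

_∖ₜ_ : Term → Term → Term
s ∖ₜ t = ∁ₜ (∁ₜ s ∪ₜ ∁ₜ ∁ₜ t)

-- ⟦ s ∖ₜ t ⟧ N P w unfolds to ¬ (¬ A ⊎ ¬ ¬ B) with A = ⟦ s ⟧ N P w and B = ⟦ t ⟧ N P w.
∖-intro : A → ¬ B → ¬ (¬ A ⊎ ¬ ¬ B)
∖-intro p ¬q = [ (λ ¬p → ¬p p) , (λ ¬¬q → ¬¬q ¬q) ]

∖-elimˡ : ¬ (¬ A ⊎ ¬ ¬ B) → ¬ ¬ A
∖-elimˡ h ¬p = h (inj₁ ¬p)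

∖-elimʳ : ¬ (¬ A ⊎ ¬ ¬ B) → ¬ B
∖-elimʳ h = negated-stable (λ ¬q → h (inj₂ ¬q))

◇ⁿ : ℕ → Term
◇ⁿ zero = var
◇ⁿ (suc n) = ◇ₜ ◇ⁿ n

sphere : ℕ → Term
sphere zero = var
sphere (suc k) = ◇ⁿ (suc k) ∖ₜ ◇ⁿ k

deadEnd : ℕ → Term
deadEnd k = sphere k ∖ₜ ◇ₜ sphere (suc k)

avoidsDeadEnd : ℕ → Term
avoidsDeadEnd k = sphere k ∖ₜ ◇ₜ deadEnd (suc k)

module _ {M N : SubE} (e : Embedding M N) where
  open Embedding e

  image-d : Sub
  image-d = proj₁ (f (dD M))

  private
    element : Term → D M
    element t = ⟦ t ⟧ M ｛d｝ , Gen-⟦⟧ t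

    f-⟦⟧ : (t : Term) → proj₁ (f (element t)) ≐ ⟦ t ⟧ N image-d
    f-⟦⟧ var = ≐-refl
    f-⟦⟧ ∅ₜ = f-∅
    f-⟦⟧ (∁ₜ t) = ≐-trans (f-∁ (element t)) (∁-cong (f-⟦⟧ t))
    f-⟦⟧ (s ∪ₜ t) = ≐-trans (f-∪ (element s) (element t)) (∪-cong (f-⟦⟧ s) (f-⟦⟧ t))
    f-⟦⟧ (◇ₜ t) = ≐-trans (f-◇ (element t)) (◇-cong {N = N} (f-⟦⟧ t))

  ≐-preserved : (s t : Term) → ⟦ s ⟧ M ｛d｝ ≐ ⟦ t ⟧ M ｛d｝ → ⟦ s ⟧ N image-d ≐ ⟦ t ⟧ N image-d
  ≐-preserved s t eq =
    ≐-trans (≐-sym (f-⟦⟧ s)) (≐-trans (f-resp (element s) (element t) eq) (f-⟦⟧ t))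

  ≐-reflected : (s t : Term) → ⟦ s ⟧ N image-d ≐ ⟦ t ⟧ N image-d → ⟦ s ⟧ M ｛d｝ ≐ ⟦ t ⟧ M ｛d｝
  ≐-reflected s t eq =
    f-inj (element s) (element t) (≐-trans (f-⟦⟧ s) (≐-trans eq (≐-sym (f-⟦⟧ t))))

module Frame (N : SubE) where

  R-refl : R N w w
  R-refl = inj₁ refl

  R-sym : R N x y → R N y x
  R-sym (inj₁ refl) = inj₁ refl
  R-sym (inj₂ (inj₁ e)) = inj₂ (inj₂ e)
  R-sym (inj₂ (inj₂ e)) = inj₂ (inj₁ e)

  edge⁺ : Edge (proj₁ N) x y → R N x y
  edge⁺ e = inj₂ (inj₁ e)

  edge⁻ : Edge (proj₁ N) y x → R N x y
  edge⁻ e = inj₂ (inj₂ e)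

  ◇-inflationary : Q w → ◇ N Q w
  ◇-inflationary q = _ , R-refl , q

  ◇-step : R N w x → Q x → ◇ N Q w
  ◇-step r q = _ , r , q

  R²-a : ∀ w → w ≢ d → ∃ λ x → R N w x × R N x a
  R²-a a _ = a , R-refl , R-refl
  R²-a b₁ _ = a , edge⁻ ab₁ , R-refl
  R²-a b₂ _ = a , edge⁻ ab₂ , R-refl
  R²-a b₃ _ = a , edge⁻ ab₃ , R-refl
  R²-a c₁ _ = b₁ , edge⁻ b₁c₁ , edge⁻ ab₁
  R²-a c₂ _ = b₂ , edge⁻ b₂c₂ , edge⁻ ab₂
  R²-a d d≢d = ⊥-elim (d≢d refl)
  R²-a (u k) _ = ℓ (suc k) , edge⁻ (ℓu-same k) , edge⁻ (aℓ (suc k))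
  R²-a (ℓ i) _ = a , edge⁻ (aℓ i) , R-refl

  ◇²-from-a : Q a → w ≢ d → ◇ N (◇ N Q) w
  ◇²-from-a {w = w} q w≢d with R²-a w w≢d
  ... | x , r , r′ = ◇-step r (◇-step r′ q)

  ◇²-to-a : Q w → w ≢ d → ◇ N (◇ N Q) a
  ◇²-to-a {w = w} q w≢d with R²-a w w≢d
  ... | x , r , r′ = ◇-step (R-sym r′) (◇-step (R-sym r) q)

  R-b₁ : R N x b₁ → x ≡ b₁ ⊎ x ≡ a ⊎ x ≡ c₁
  R-b₁ (inj₁ refl) = inj₁ refl
  R-b₁ (inj₂ (inj₁ ab₁)) = inj₂ (inj₁ refl)
  R-b₁ (inj₂ (inj₂ b₁c₁)) = inj₂ (inj₂ refl)

  R-b₃ : R N x b₃ → x ≡ b₃ ⊎ x ≡ a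
  R-b₃ (inj₁ refl) = inj₁ refl
  R-b₃ (inj₂ (inj₁ ab₃)) = inj₂ refl

  dist-d : W → ℕ
  dist-d a = 3
  dist-d b₁ = 2
  dist-d b₂ = 4
  dist-d b₃ = 4
  dist-d c₁ = 1
  dist-d c₂ = 5
  dist-d d = 0
  dist-d (u _) = 5
  dist-d (ℓ _) = 4

  private
    ≤-by-computation : ∀ {m n} {_ : T (m ≤ᵇ n)} → m ≤ n
    ≤-by-computation {m} {n} {m≤ᵇn} = ≤ᵇ⇒≤ m n m≤ᵇn

    dist-d-edge : Edge (proj₁ N) x y → dist-d x ≤ suc (dist-d y) × dist-d y ≤ suc (dist-d x)
    dist-d-edge ab₁ = ≤-by-computation , ≤-by-computation
    dist-d-edge ab₂ = ≤-by-computation , ≤-by-computation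
    dist-d-edge ab₃ = ≤-by-computation , ≤-by-computation
    dist-d-edge b₁c₁ = ≤-by-computation , ≤-by-computation
    dist-d-edge b₂c₂ = ≤-by-computation , ≤-by-computation
    dist-d-edge c₁d = ≤-by-computation , ≤-by-computation
    dist-d-edge ℓ₀ℓ₁ = ≤-by-computation , ≤-by-computation
    dist-d-edge (aℓ _) = ≤-by-computation , ≤-by-computation
    dist-d-edge (ℓu-same _) = ≤-by-computation , ≤-by-computation
    dist-d-edge (ℓu-prev _ _) = ≤-by-computation , ≤-by-computation
    dist-d-edge (ℓu-next _ _) = ≤-by-computation , ≤-by-computation
    dist-d-edge (ℓu-back _ _ _) = ≤-by-computation , ≤-by-computation

  dist-d-R : R N x y → dist-d x ≤ suc (dist-d y)
  dist-d-R {x = x} (inj₁ refl) = n≤1+n (dist-d x)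
  dist-d-R (inj₂ (inj₁ e)) = proj₁ (dist-d-edge e)
  dist-d-R (inj₂ (inj₂ e)) = proj₂ (dist-d-edge e)

  ◇ⁿ｛d｝⇒dist-d≤ : ∀ n → ⟦ ◇ⁿ n ⟧ N ｛d｝ w → dist-d w ≤ n
  ◇ⁿ｛d｝⇒dist-d≤ zero refl = z≤n
  ◇ⁿ｛d｝⇒dist-d≤ (suc n) (x , r , p) = ≤-trans (dist-d-R r) (s≤s (◇ⁿ｛d｝⇒dist-d≤ n p))

  dist-d≤3⇒≡a⊎◇² : dist-d w ≤ 3 → w ≡ a ⊎ ⟦ ◇ⁿ 2 ⟧ N ｛d｝ w
  dist-d≤3⇒≡a⊎◇² {a} _ = inj₁ refl
  dist-d≤3⇒≡a⊎◇² {b₁} _ = inj₂ (◇-step (edge⁺ b₁c₁) (◇-step (edge⁺ c₁d) refl))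
  dist-d≤3⇒≡a⊎◇² {c₁} _ = inj₂ (◇-inflationary (◇-step (edge⁺ c₁d) refl))
  dist-d≤3⇒≡a⊎◇² {d} _ = inj₂ (◇-inflationary (◇-inflationary refl))
  dist-d≤3⇒≡a⊎◇² {b₂} (s≤s (s≤s (s≤s ())))
  dist-d≤3⇒≡a⊎◇² {b₃} (s≤s (s≤s (s≤s ())))
  dist-d≤3⇒≡a⊎◇² {c₂} (s≤s (s≤s (s≤s ())))
  dist-d≤3⇒≡a⊎◇² {u _} (s≤s (s≤s (s≤s ())))
  dist-d≤3⇒≡a⊎◇² {ℓ _} (s≤s (s≤s (s≤s ())))

  ◇⁴｛d｝-misses-c₂ : ¬ ⟦ ◇ⁿ 4 ⟧ N ｛d｝ c₂
  ◇⁴｛d｝-misses-c₂ p = 1+n≰n (◇ⁿ｛d｝⇒dist-d≤ 4 p)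

  sphere₃｛d｝⊆｛a｝ : ⟦ sphere 3 ⟧ N ｛d｝ w → ¬ ¬ (w ≡ a)
  sphere₃｛d｝⊆｛a｝ p w≢a =
    ∖-elimˡ p λ p₃ → [ w≢a , ∖-elimʳ p ] (dist-d≤3⇒≡a⊎◇² (◇ⁿ｛d｝⇒dist-d≤ 3 p₃))

  deadEnd₄｛d｝-b₃ : ⟦ deadEnd 4 ⟧ N ｛d｝ b₃
  deadEnd₄｛d｝-b₃ = ∖-intro (∖-intro b₃∈◇⁴ b₃∉◇³) b₃∉◇sphere₅
    where
    a∈◇³ : ⟦ ◇ⁿ 3 ⟧ N ｛d｝ a
    a∈◇³ = ◇-step (edge⁺ ab₁) (◇-step (edge⁺ b₁c₁) (◇-step (edge⁺ c₁d) refl))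
    b₃∈◇⁴ : ⟦ ◇ⁿ 4 ⟧ N ｛d｝ b₃
    b₃∈◇⁴ = ◇-step (edge⁻ ab₃) a∈◇³
    b₃∉◇³ : ¬ ⟦ ◇ⁿ 3 ⟧ N ｛d｝ b₃
    b₃∉◇³ p = 1+n≰n (◇ⁿ｛d｝⇒dist-d≤ 3 p)
    b₃∉◇sphere₅ : ¬ ⟦ ◇ₜ sphere 5 ⟧ N ｛d｝ b₃
    b₃∉◇sphere₅ (x , r , p) with R-b₃ (R-sym r)
    ... | inj₁ refl = ∖-elimʳ p b₃∈◇⁴
    ... | inj₂ refl = ∖-elimʳ p (◇-inflationary a∈◇³)

  avoidsDeadEnd₃｛d｝-empty : ∀ w → ¬ ⟦ avoidsDeadEnd 3 ⟧ N ｛d｝ w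
  avoidsDeadEnd₃｛d｝-empty w p =
    ∖-elimˡ p λ p₃ → sphere₃｛d｝⊆｛a｝ p₃ λ { refl → ∖-elimʳ p (◇-step (edge⁺ ab₃) deadEnd₄｛d｝-b₃) }

  module _ {P : Sub}
           (◇⁴-not-full : ¬ (∀ w → ⟦ ◇ⁿ 4 ⟧ N P w))
           (avoidsDeadEnd₃-empty : ∀ w → ¬ ⟦ avoidsDeadEnd 3 ⟧ N P w) where

    private
      d∉◇⁴ : ⟦ ◇ⁿ 2 ⟧ N P a → ¬ ⟦ ◇ⁿ 4 ⟧ N P d
      d∉◇⁴ a∈◇² d∈◇⁴ = ◇⁴-not-full covered
        where
        covered : ∀ w → ⟦ ◇ⁿ 4 ⟧ N P w
        covered w with w ≟d
        ... | yes refl = d∈◇⁴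
        ... | no w≢d = ◇²-from-a a∈◇² w≢d

      b₁-avoidsDeadEnd₃ : ⟦ ◇ⁿ 2 ⟧ N P a → ⟦ avoidsDeadEnd 3 ⟧ N P b₁
      b₁-avoidsDeadEnd₃ a∈◇² = ∖-intro (∖-intro b₁∈◇³ b₁∉◇²) b₁∉◇deadEnd₄
        where
        b₁∈◇³ : ⟦ ◇ⁿ 3 ⟧ N P b₁
        b₁∈◇³ = ◇-step (edge⁻ ab₁) a∈◇²
        b₁∉◇² : ¬ ⟦ ◇ⁿ 2 ⟧ N P b₁
        b₁∉◇² p = d∉◇⁴ a∈◇² (◇-step (edge⁻ c₁d) (◇-step (edge⁻ b₁c₁) p))
        d∈sphere₅ : ⟦ sphere 5 ⟧ N P d
        d∈sphere₅ = ∖-intro (◇-step (edge⁻ c₁d) (◇-step (edge⁻ b₁c₁) b₁∈◇³)) (d∉◇⁴ a∈◇²)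
        b₁∉◇deadEnd₄ : ¬ ⟦ ◇ₜ deadEnd 4 ⟧ N P b₁
        b₁∉◇deadEnd₄ (x , r , p) with R-b₁ (R-sym r)
        ... | inj₁ refl = ∖-elimˡ p λ q → ∖-elimʳ q b₁∈◇³
        ... | inj₂ (inj₁ refl) = ∖-elimˡ p λ q → ∖-elimʳ q (◇-inflationary a∈◇²)
        ... | inj₂ (inj₂ refl) = ∖-elimʳ p (◇-step (edge⁺ c₁d) d∈sphere₅)

    ⊆｛d｝ : ∀ w → P w → w ≡ d
    ⊆｛d｝ w p with w ≟d
    ... | yes w≡d = w≡d
    ... | no w≢d = ⊥-elim (avoidsDeadEnd₃-empty b₁ (b₁-avoidsDeadEnd₃ (◇²-to-a p w≢d)))

lemma3p15 : (M N : SubE) (e : Embedding M N) →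
    proj₁ (Embedding.f e (dD M)) ≐ ｛d｝
lemma3p15 M N e = ≐｛d｝-intro (Frame.⊆｛d｝ N ◇⁴-not-full avoidsDeadEnd₃-empty) nonempty decided
  where
  ◇⁴-not-full : ¬ (∀ w → ⟦ ◇ⁿ 4 ⟧ N (image-d e) w)
  ◇⁴-not-full full =
    Frame.◇⁴｛d｝-misses-c₂ M (proj₂ (≐-reflected e (◇ⁿ 4) (∁ₜ ∅ₜ) (≐⊤-intro full) c₂) λ ())

  avoidsDeadEnd₃-empty : ∀ w → ¬ ⟦ avoidsDeadEnd 3 ⟧ N (image-d e) w
  avoidsDeadEnd₃-empty w =
    proj₁ (≐-preserved e (avoidsDeadEnd 3) ∅ₜ (≐∅-intro (Frame.avoidsDeadEnd₃｛d｝-empty M)) w)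

  nonempty : ¬ (image-d e ≐ ∅)
  nonempty empty = proj₁ (≐-reflected e var ∅ₜ empty d) refl

  decided : image-d e d ⊎ ¬ image-d e d
  decided = proj₂ (≐-preserved e (var ∪ₜ ∁ₜ var) (∁ₜ ∅ₜ) excluded-middle d) λ ()
    where
    excluded-middle : (｛d｝ ∪ ∁ ｛d｝) ≐ ∁ ∅
    excluded-middle = ≐⊤-intro λ w → toSum (w ≟d)
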